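{- For every integer $k\ge 6$ that is a multiple of $6$, \[ \mathrm{ex}(2k,X_k) < (2k)^2 - k^2/18. \]
   Context: For an even integer $k$, $X_k$ is the $k\times k$ binary matrix with $1$-entries exactly at the positions $(i,j)$, $i,j\in[k]$, with $i=j$ or $i+j=k+1$. A binary matrix $A$ contains $B$ if $B$ can be obtained from $A$ by deleting some rows, some columns, and changing some $1$-entries to $0$-entries; otherwise $A$ avoids $B$. $\mathrm{ex}(n,B)$ is the maximum number of $1$-entries in an $n\times n$ binary matrix avoiding $B$. -}

module Defs where

open import Data.Nat using (ℕ; zero; suc; _+_; _*_; _<_)
open import Data.Bool using (Bool; true; false; _∨_)
open import Data.Fin using (Fin; toℕ) renaming (_<_ to _<ᶠ_)
open import Data.Product using (Σ; _×_; ∃-syntax)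
open import Relation.Binary.PropositionalEquality using (_≡_)
open import Relation.Nullary using (¬_)
open import Data.Nat using (_≟_)
open import Relation.Nullary.Decidable using (⌊_⌋)

Matrix : ℕ → ℕ → Set
Matrix m n = Fin m → Fin n → Bool

-- X_k : ones exactly at (i,j) with i = j or i + j = k + 1 (1-indexed);
-- 0-indexed: i = j or i + j = k - 1, i.e. i + j + 1 = k.
X : (k : ℕ) → Matrix k k
X k i j = ⌊ toℕ i ≟ toℕ j ⌋ ∨ ⌊ toℕ i + toℕ j + 1 ≟ k ⌋

StrictlyIncreasing : {p q : ℕ} → (Fin p → Fin q) → Set
StrictlyIncreasing {p} f = (a b : Fin p) → a <ᶠ b → f a <ᶠ f b

-- A contains B: delete rows/columns (keep an increasing selection),
-- then turn some 1s into 0s: every 1 of B sits on a 1 of A.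
Contains : {m n p q : ℕ} → Matrix m n → Matrix p q → Set
Contains {m} {n} {p} {q} A B =
  Σ (Fin p → Fin m) λ f → Σ (Fin q → Fin n) λ g →
    StrictlyIncreasing f × StrictlyIncreasing g ×
    ((i : Fin p) (j : Fin q) → B i j ≡ true → A (f i) (g j) ≡ true)

Avoids : {m n p q : ℕ} → Matrix m n → Matrix p q → Set
Avoids A B = ¬ Contains A B

countFin : {n : ℕ} → (Fin n → ℕ) → ℕ
countFin {zero} f = 0
countFin {suc n} f = f Fin.zero + countFin (λ i → f (Fin.suc i))

bit : Bool → ℕ
bit true = 1
bit false = 0

ones : {m n : ℕ} → Matrix m n → ℕ
ones A = countFin (λ i → countFin (λ j → bit (A i j)))

-- Fold the 2k × 2k matrix A into the k × k matrix B whose entry (i, j) is the conjunction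
-- of the four entries of A at (i, j) and its reflections in the two midlines; B has at most
-- as many zeros as A.  Write k = 2h with h = z + D.  If A has fewer than (D + 1)(z + 1)
-- zeros, one of the D + 1 diagonals {(u + d, u) : u < z + h}, d ≤ D, of B carries at most
-- z zeros, hence h ones.  Their rows and columns, together with their reflections, are k
-- rows and k columns of A on which both the diagonal and the antidiagonal are all ones:
-- a copy of X_k.  For k = 6m we take z = m and D = 2m, so an X_k-free matrix has more
-- than 2m² = k²/18 zeros.
module Submission where

open import Data.Bool using (Bool; true; false; not; _∧_)
open import Data.Bool.Properties using (∧-conicalˡ; ∧-conicalʳ)
open import Data.Empty using (⊥-elim)
open import Data.Fin using (Fin; toℕ; fromℕ<)
open import Data.Fin.Properties using (toℕ<n; toℕ-fromℕ<; fromℕ<-toℕ)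
open import Data.Nat
open import Data.Nat.Properties
open import Algebra.Properties.CommutativeSemigroup +-commutativeSemigroup using (interchange)
open import Data.Nat.Tactic.RingSolver using (solve-∀)
open import Data.Product using (_×_; _,_; ∃-syntax)
open import Data.Sum using (_⊎_; inj₁; inj₂)
open import Function using (_∘_)
open import Relation.Binary.PropositionalEquality
open import Relation.Nullary using (yes; no)

open import Defs

∑ : ℕ → (ℕ → ℕ) → ℕ
∑ zero    f = 0
∑ (suc n) f = f 0 + ∑ n (f ∘ suc)

syntax ∑ n (λ i → e) = ∑[ i < n ] e

reflect : ℕ → ℕ → ℕ
reflect n i = n ∸ suc i

∑-cong : ∀ n {f g : ℕ → ℕ} → (∀ {i} → i < n → f i ≡ g i) → ∑ n f ≡ ∑ n g
∑-cong zero    f≗g = refl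
∑-cong (suc n) f≗g = cong₂ _+_ (f≗g z<s) (∑-cong n (f≗g ∘ s<s))

∑-mono-≤ : ∀ n {f g : ℕ → ℕ} → (∀ {i} → i < n → f i ≤ g i) → ∑ n f ≤ ∑ n g
∑-mono-≤ zero    f≤g = z≤n
∑-mono-≤ (suc n) f≤g = +-mono-≤ (f≤g z<s) (∑-mono-≤ n (f≤g ∘ s<s))

∑-monoˡ-≤ : ∀ {m n} (f : ℕ → ℕ) → m ≤ n → ∑ m f ≤ ∑ n f
∑-monoˡ-≤ f z≤n       = z≤n
∑-monoˡ-≤ f (s≤s m≤n) = +-monoʳ-≤ (f 0) (∑-monoˡ-≤ (f ∘ suc) m≤n)

∑-distrib-+ : ∀ n (f g : ℕ → ℕ) → ∑[ i < n ] (f i + g i) ≡ ∑ n f + ∑ n g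
∑-distrib-+ zero    f g = refl
∑-distrib-+ (suc n) f g = trans (cong (f 0 + g 0 +_) (∑-distrib-+ n (f ∘ suc) (g ∘ suc)))
                                (interchange (f 0) (g 0) (∑ n (f ∘ suc)) (∑ n (g ∘ suc)))

∑-const : ∀ n c → ∑[ _ < n ] c ≡ n * c
∑-const zero    c = refl
∑-const (suc n) c = cong (c +_) (∑-const n c)

∑-++ : ∀ m n (f : ℕ → ℕ) → ∑ (m + n) f ≡ ∑ m f + ∑[ i < n ] f (m + i)
∑-++ zero    n f = refl
∑-++ (suc m) n f = trans (cong (f 0 +_) (∑-++ m n (f ∘ suc))) (sym (+-assoc (f 0) _ _))

∑-snoc : ∀ n (f : ℕ → ℕ) → ∑ (suc n) f ≡ ∑ n f + f n
∑-snoc zero    f = +-comm (f 0) 0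
∑-snoc (suc n) f = trans (cong (f 0 +_) (∑-snoc n (f ∘ suc))) (sym (+-assoc (f 0) _ _))

∑-reverse : ∀ n (f : ℕ → ℕ) → ∑[ i < n ] f (reflect n i) ≡ ∑ n f
∑-reverse zero    f = refl
∑-reverse (suc n) f = begin
  f n + ∑[ i < n ] f (reflect n i)  ≡⟨ cong (f n +_) (∑-reverse n f) ⟩
  f n + ∑ n f                       ≡⟨ +-comm (f n) _ ⟩
  ∑ n f + f n                       ≡⟨ ∑-snoc n f ⟨
  ∑ (suc n) f                       ∎
  where open ≡-Reasoning

∑-comm : ∀ m n (f : ℕ → ℕ → ℕ) → ∑[ i < m ] ∑[ j < n ] f i j ≡ ∑[ j < n ] ∑[ i < m ] f i j
∑-comm zero    n f = sym (trans (∑-const n 0) (*-zeroʳ n))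
∑-comm (suc m) n f = begin
  ∑[ j < n ] f 0 j + ∑[ i < m ] ∑[ j < n ] f (suc i) j
    ≡⟨ cong (∑[ j < n ] f 0 j +_) (∑-comm m n (f ∘ suc)) ⟩
  ∑[ j < n ] f 0 j + ∑[ j < n ] ∑[ i < m ] f (suc i) j
    ≡⟨ ∑-distrib-+ n (f 0) (λ j → ∑[ i < m ] f (suc i) j) ⟨
  ∑[ j < n ] ∑[ i < suc m ] f i j
    ∎
  where open ≡-Reasoning

pigeonhole : ∀ n c (f : ℕ → ℕ) → ∑ n f < n * c → ∃[ i ] i < n × f i < c
pigeonhole (suc n) c f small with f 0 <? c
... | yes f0<c = 0 , z<s , f0<c
... | no  f0≮c =
  let i , i<n , fi<c = pigeonhole n c (f ∘ suc)
                         (+-cancelˡ-< c _ _ (≤-<-trans (+-monoˡ-≤ _ (≮⇒≥ f0≮c)) small))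
  in suc i , s<s i<n , fi<c

bit+bit-not : ∀ b → bit b + bit (not b) ≡ 1
bit+bit-not true  = refl
bit+bit-not false = refl

bit-not-∧ : ∀ a b → bit (not (a ∧ b)) ≤ bit (not a) + bit (not b)
bit-not-∧ true  b = ≤-refl
bit-not-∧ false b = s≤s z≤n

∑-bits : ∀ n (v : ℕ → Bool) → ∑[ i < n ] bit (v i) + ∑[ i < n ] bit (not (v i)) ≡ n
∑-bits n v = begin
  ∑[ i < n ] bit (v i) + ∑[ i < n ] bit (not (v i))  ≡⟨ ∑-distrib-+ n _ _ ⟨
  ∑[ i < n ] (bit (v i) + bit (not (v i)))          ≡⟨ ∑-cong n (λ {i} _ → bit+bit-not (v i)) ⟩
  ∑[ _ < n ] 1                                      ≡⟨ ∑-const n 1 ⟩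
  n * 1                                             ≡⟨ *-identityʳ n ⟩
  n                                                 ∎
  where open ≡-Reasoning

many-ones : ∀ z h (v : ℕ → Bool) →
            ∑[ i < z + h ] bit (not (v i)) ≤ z → h ≤ ∑[ i < z + h ] bit (v i)
many-ones z h v sparse = +-cancelˡ-≤ z h _ (begin
  z + h                                                    ≡⟨ ∑-bits (z + h) v ⟨
  ∑[ i < z + h ] bit (v i) + ∑[ i < z + h ] bit (not (v i))  ≤⟨ +-monoʳ-≤ _ sparse ⟩
  ∑[ i < z + h ] bit (v i) + z                              ≡⟨ +-comm _ z ⟩
  z + ∑[ i < z + h ] bit (v i)                              ∎)
  where open ≤-Reasoning

record Increasing (p q : ℕ) (E : ℕ → ℕ) : Set where
  field
    monotone : ∀ {a b} → a < b → b < p → E a < E b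
    bounded  : ∀ {a} → a < p → E a < q

open Increasing

Increasing-weaken : ∀ {p q q′ E} → q ≤ q′ → Increasing p q E → Increasing p q′ E
Increasing-weaken q≤q′ inc = record
  { monotone = monotone inc
  ; bounded  = λ a<p → <-≤-trans (bounded inc a<p) q≤q′
  }

Increasing-+ : ∀ {p q E} d → Increasing p q E → Increasing p (q + d) (λ a → E a + d)
Increasing-+ d inc = record
  { monotone = λ a<b b<p → +-monoˡ-< d (monotone inc a<b b<p)
  ; bounded  = λ a<p → +-monoˡ-< d (bounded inc a<p)
  }

enumerate-trues : ∀ L (v : ℕ → Bool) {h} → h ≤ ∑[ i < L ] bit (v i) →
                  ∃[ E ] Increasing h L E × (∀ {a} → a < h → v (E a) ≡ true)
enumerate-trues L       v {zero}  _ = (λ _ → 0) , record { monotone = λ _ () ; bounded = λ () } , λ ()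
enumerate-trues (suc L) v {suc h} h<trues with v 0 in v0≡true
... | true =
  let E , inc , trues = enumerate-trues L (v ∘ suc) (s≤s⁻¹ h<trues)
      E′ : ℕ → ℕ
      E′ = λ { zero → 0 ; (suc a) → suc (E a) }
  in E′
   , record
       { monotone = λ { {zero} {suc b} _ _ → z<s
                      ; {suc a} {suc b} a<b b<h → s<s (monotone inc (s<s⁻¹ a<b) (s<s⁻¹ b<h)) }
       ; bounded  = λ { {zero} _ → z<s ; {suc a} a<h → s<s (bounded inc (s<s⁻¹ a<h)) }
       }
   , λ { {zero} _ → v0≡true ; {suc a} a<h → trues (s<s⁻¹ a<h) }
... | false =
  let E , inc , trues = enumerate-trues L (v ∘ suc) h<trues
  in suc ∘ E
   , record { monotone = λ a<b b<h → s<s (monotone inc a<b b<h) ; bounded = s<s ∘ bounded inc }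
   , trues

reflect-< : ∀ {n i} → i < n → reflect n i < n
reflect-< i<n = ∸-monoʳ-< z<s i<n

reflect-antitone : ∀ {n i j} → i < j → j < n → reflect n j < reflect n i
reflect-antitone i<j j<n = ∸-monoʳ-< (s<s i<j) j<n

reflect-+ : ∀ m {n i} → i < n → reflect (m + n) i ≡ m + reflect n i
reflect-+ m i<n = +-∸-assoc m i<n

m≤reflect-m+n : ∀ m {n i} → i < n → m ≤ reflect (m + n) i
m≤reflect-m+n m i<n = subst (m ≤_) (sym (reflect-+ m i<n)) (m≤m+n m _)

reflect-upper-half : ∀ {h a} → h ≤ a → a < h + h → reflect (h + h) a < h
reflect-upper-half {h} {a} h≤a a<2h = +-cancelʳ-< h _ h (begin-strict
  reflect (h + h) a + h      ≤⟨ +-monoʳ-≤ _ h≤a ⟩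
  reflect (h + h) a + a      <⟨ +-monoʳ-< _ ≤-refl ⟩
  reflect (h + h) a + suc a  ≡⟨ m∸n+n≡m a<2h ⟩
  h + h                      ∎)
  where open ≤-Reasoning

reflect-partner : ∀ {n i j} → i + j + 1 ≡ n → reflect n j ≡ i
reflect-partner {i = i} {j} refl = begin
  i + j + 1 ∸ suc j  ≡⟨ cong (_∸ suc j) (trans (+-assoc i j 1) (cong (i +_) (+-comm j 1))) ⟩
  i + suc j ∸ suc j  ≡⟨ m+n∸n≡m i (suc j) ⟩
  i                  ∎
  where open ≡-Reasoning

partner-upper-half : ∀ {h i j} → i + j + 1 ≡ h + h → i < h → h ≤ j
partner-upper-half {h} {i} {j} i+j+1≡2h i<h = +-cancelˡ-≤ h h j (begin
  h + h      ≡⟨ i+j+1≡2h ⟨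
  i + j + 1  ≡⟨ +-comm (i + j) 1 ⟩
  suc i + j  ≤⟨ +-monoˡ-≤ j i<h ⟩
  h + j      ∎)
  where open ≤-Reasoning

partner-lower-half : ∀ {h i j} → i + j + 1 ≡ h + h → h ≤ i → j < h
partner-lower-half {h} {i} {j} i+j+1≡2h h≤i = +-cancelˡ-≤ h (suc j) h (begin
  h + suc j  ≤⟨ +-monoˡ-≤ (suc j) h≤i ⟩
  i + suc j  ≡⟨ +-suc i j ⟩
  suc i + j  ≡⟨ +-comm (i + j) 1 ⟨
  i + j + 1  ≡⟨ i+j+1≡2h ⟩
  h + h      ∎)
  where open ≤-Reasoning

mirror : ℕ → ℕ → (ℕ → ℕ) → ℕ → ℕ
mirror h n e a with a <? h
... | yes _ = e a
... | no  _ = reflect (n + n) (e (reflect (h + h) a))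

mirror-lower : ∀ {h n e a} → a < h → mirror h n e a ≡ e a
mirror-lower {h} {a = a} a<h with a <? h
... | yes _   = refl
... | no  a≮h = ⊥-elim (a≮h a<h)

mirror-upper : ∀ {h n e a} → h ≤ a → mirror h n e a ≡ reflect (n + n) (e (reflect (h + h) a))
mirror-upper {h} {a = a} h≤a with a <? h
... | yes a<h = ⊥-elim (<⇒≱ a<h h≤a)
... | no  _   = refl

Increasing-mirror : ∀ {h n e} → Increasing h n e → Increasing (h + h) (n + n) (mirror h n e)
Increasing-mirror {h} {n} {e} inc = record { monotone = mono ; bounded = bound }
  where
  reflected-< : ∀ {a} → h ≤ a → a < h + h → e (reflect (h + h) a) < n
  reflected-< h≤a a<2h = bounded inc (reflect-upper-half h≤a a<2h)

  mono : ∀ {a b} → a < b → b < h + h → mirror h n e a < mirror h n e b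
  mono {a} {b} a<b b<2h with a <? h | b <? h
  ... | yes _   | yes b<h = monotone inc a<b b<h
  ... | yes a<h | no  b≮h = <-≤-trans (bounded inc a<h) (m≤reflect-m+n n (reflected-< (≮⇒≥ b≮h) b<2h))
  ... | no  a≮h | yes b<h = ⊥-elim (a≮h (<-trans a<b b<h))
  ... | no  a≮h | no  b≮h =
    reflect-antitone
      (monotone inc (reflect-antitone a<b b<2h) (reflect-upper-half (≮⇒≥ a≮h) (<-trans a<b b<2h)))
      (m≤n⇒m≤n+o n (reflected-< (≮⇒≥ a≮h) (<-trans a<b b<2h)))

  bound : ∀ {a} → a < h + h → mirror h n e a < n + n
  bound {a} a<2h with a <? h
  ... | yes a<h = m≤n⇒m≤n+o n (bounded inc a<h)
  ... | no  a≮h = reflect-< (m≤n⇒m≤n+o n (reflected-< (≮⇒≥ a≮h) a<2h))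

Grid : Set
Grid = ℕ → ℕ → Bool

fold : ℕ → Grid → Grid
fold n M i j = M i j ∧ M i (r j) ∧ M (r i) j ∧ M (r i) (r j)
  where r = reflect (n + n)

cornerZeros : ℕ → Grid → ℕ
cornerZeros n M = ∑[ i < n ] ∑[ j < n ] bit (not (M i j))

∑-reflect-halves : ∀ n (f : ℕ → ℕ) → ∑[ j < n ] (f j + f (reflect (n + n) j)) ≡ ∑ (n + n) f
∑-reflect-halves n f = begin
  ∑[ j < n ] (f j + f (reflect (n + n) j))    ≡⟨ ∑-distrib-+ n f _ ⟩
  ∑ n f + ∑[ j < n ] f (reflect (n + n) j)    ≡⟨ cong (∑ n f +_) (∑-cong n (cong f ∘ reflect-+ n)) ⟩
  ∑ n f + ∑[ j < n ] f (n + reflect n j)      ≡⟨ cong (∑ n f +_) (∑-reverse n (f ∘ (n +_))) ⟩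
  ∑ n f + ∑[ j < n ] f (n + j)                ≡⟨ ∑-++ n n f ⟨
  ∑ (n + n) f                                 ∎
  where open ≡-Reasoning

cornerZeros-fold : ∀ n (M : Grid) → cornerZeros n (fold n M) ≤ cornerZeros (n + n) M
cornerZeros-fold n M = begin
  ∑[ i < n ] ∑[ j < n ] bit (not (fold n M i j))
    ≤⟨ ∑-mono-≤ n (λ {i} _ → ∑-mono-≤ n (λ {j} _ → quadrants i j)) ⟩
  ∑[ i < n ] ∑[ j < n ] ((Z i j + Z i (r j)) + (Z (r i) j + Z (r i) (r j)))
    ≡⟨ ∑-cong n (λ {i} _ → ∑-distrib-+ n _ _) ⟩
  ∑[ i < n ] (∑[ j < n ] (Z i j + Z i (r j)) + ∑[ j < n ] (Z (r i) j + Z (r i) (r j)))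
    ≡⟨ ∑-cong n (λ {i} _ → cong₂ _+_ (∑-reflect-halves n (Z i)) (∑-reflect-halves n (Z (r i)))) ⟩
  ∑[ i < n ] (∑ (n + n) (Z i) + ∑ (n + n) (Z (r i)))
    ≡⟨ ∑-reflect-halves n (λ i → ∑ (n + n) (Z i)) ⟩
  ∑[ i < n + n ] ∑ (n + n) (Z i)
    ∎
  where
  open ≤-Reasoning
  r = reflect (n + n)
  Z : ℕ → ℕ → ℕ
  Z i j = bit (not (M i j))
  quadrants : ∀ i j → bit (not (fold n M i j)) ≤ (Z i j + Z i (r j)) + (Z (r i) j + Z (r i) (r j))
  quadrants i j = ≤-trans (bit-not-∧ (M i j) _)
    (≤-trans (+-monoʳ-≤ (Z i j) (≤-trans (bit-not-∧ (M i (r j)) _)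
                                         (+-monoʳ-≤ (Z i (r j)) (bit-not-∧ (M (r i) j) _))))
             (≤-reflexive (sym (+-assoc (Z i j) _ _))))

∑-window : ∀ {u w n} → u + w ≤ n → (f : ℕ → ℕ) → ∑[ d < w ] f (u + d) ≤ ∑ n f
∑-window {u} {w} {n} u+w≤n f = begin
  ∑[ d < w ] f (u + d)          ≤⟨ m≤n+m _ (∑ u f) ⟩
  ∑ u f + ∑[ d < w ] f (u + d)  ≡⟨ ∑-++ u w f ⟨
  ∑ (u + w) f                   ≤⟨ ∑-monoˡ-≤ f u+w≤n ⟩
  ∑ n f                         ∎
  where open ≤-Reasoning

∑-diagonals≤cornerZeros : ∀ {L D n} (M : Grid) → L + D ≤ n →
  ∑[ d < suc D ] ∑[ u < L ] bit (not (M (u + d) u)) ≤ cornerZeros n M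
∑-diagonals≤cornerZeros {L} {D} {n} M L+D≤n = begin
  ∑[ d < suc D ] ∑[ u < L ] bit (not (M (u + d) u))  ≡⟨ ∑-comm (suc D) L (λ d u → bit (not (M (u + d) u))) ⟩
  ∑[ u < L ] ∑[ d < suc D ] bit (not (M (u + d) u))  ≤⟨ ∑-mono-≤ L (λ u<L → ∑-window (fits u<L) _) ⟩
  ∑[ u < L ] ∑[ i < n ] bit (not (M i u))            ≤⟨ ∑-monoˡ-≤ _ (≤-trans (m≤m+n L D) L+D≤n) ⟩
  ∑[ u < n ] ∑[ i < n ] bit (not (M i u))            ≡⟨ ∑-comm n n _ ⟩
  cornerZeros n M                                    ∎
  where
  open ≤-Reasoning
  fits : ∀ {u} → u < L → u + suc D ≤ n
  fits {u} u<L = ≤-trans (≤-reflexive (+-suc u D)) (≤-trans (+-monoˡ-≤ D u<L) L+D≤n)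

sparse-diagonal : ∀ {z h D n} (M : Grid) → z + h + D ≤ n → cornerZeros n M < suc D * suc z →
                  ∃[ d ] d ≤ D × h ≤ ∑[ u < z + h ] bit (M (u + d) u)
sparse-diagonal {z} {h} {D} M fits few =
  let d , d<1+D , sparse = pigeonhole (suc D) (suc z) (λ d → ∑[ u < z + h ] bit (not (M (u + d) u)))
                             (≤-<-trans (∑-diagonals≤cornerZeros {z + h} M fits) few)
  in d , s≤s⁻¹ d<1+D , many-ones z h (λ u → M (u + d) u) (s≤s⁻¹ sparse)

fold-true : ∀ n (M : Grid) {i j} → fold n M i j ≡ true →
            let r = reflect (n + n) in
            M i j ≡ true × M i (r j) ≡ true × M (r i) j ≡ true × M (r i) (r j) ≡ true
fold-true n M {i} {j} folded =
    ∧-conicalˡ (M i j) _ folded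
  , ∧-conicalˡ (M i (r j)) _ rest
  , ∧-conicalˡ (M (r i) j) _ (∧-conicalʳ (M i (r j)) _ rest)
  , ∧-conicalʳ (M (r i) j) _ (∧-conicalʳ (M i (r j)) _ rest)
  where
  r = reflect (n + n)
  rest = ∧-conicalʳ (M i j) _ folded

mirror-hits-X : ∀ {h n e f} (M : Grid) → (∀ {a} → a < h → fold n M (e a) (f a) ≡ true) →
                ∀ {i j} → i < h + h → i ≡ j ⊎ i + j + 1 ≡ h + h →
                M (mirror h n e i) (mirror h n f j) ≡ true
mirror-hits-X {h} {n} M folded {i} i<2h (inj₁ refl) with i <? h
... | yes i<h = let hit , _ , _ , _ = fold-true n M (folded i<h) in hit
... | no  i≮h =
  let _ , _ , _ , hit = fold-true n M (folded (reflect-upper-half (≮⇒≥ i≮h) i<2h)) in hit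
mirror-hits-X {h} {n} {e} {f} M folded {i} {j} i<2h (inj₂ partners) with i <? h
... | yes i<h =
  let _ , hit , _ , _ = fold-true n M (folded i<h)
  in subst (λ y → M (e i) y ≡ true)
       (sym (trans (mirror-upper (partner-upper-half partners i<h))
                   (cong (reflect (n + n) ∘ f) (reflect-partner partners))))
       hit
... | no i≮h =
  let j<h = partner-lower-half partners (≮⇒≥ i≮h)
      _ , _ , hit , _ = fold-true n M (folded j<h)
  in subst₂ (λ x y → M x y ≡ true)
       (cong (reflect (n + n) ∘ e) (sym (reflect-partner (trans (cong (_+ 1) (+-comm j i)) partners))))
       (sym (mirror-lower j<h))
       hit

entry : ∀ {m n} → Matrix m n → Grid
entry {m} {n} A i j with i <? m | j <? n
... | yes i<m | yes j<n = A (fromℕ< i<m) (fromℕ< j<n)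
... | _       | _       = false

entry-toℕ : ∀ {m n} (A : Matrix m n) (i : Fin m) (j : Fin n) → entry A (toℕ i) (toℕ j) ≡ A i j
entry-toℕ {m} {n} A i j with toℕ i <? m | toℕ j <? n
... | yes i<m | yes j<n = cong₂ A (fromℕ<-toℕ i i<m) (fromℕ<-toℕ j j<n)
... | no  i≮m | _       = ⊥-elim (i≮m (toℕ<n i))
... | yes _   | no  j≮n = ⊥-elim (j≮n (toℕ<n j))

toFin : ∀ {p q E} → Increasing p q E → Fin p → Fin q
toFin inc i = fromℕ< (bounded inc (toℕ<n i))

toℕ-toFin : ∀ {p q E} (inc : Increasing p q E) (i : Fin p) → toℕ (toFin inc i) ≡ E (toℕ i)
toℕ-toFin inc i = toℕ-fromℕ< (bounded inc (toℕ<n i))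

toFin-strictlyIncreasing : ∀ {p q E} (inc : Increasing p q E) → StrictlyIncreasing (toFin inc)
toFin-strictlyIncreasing inc a b a<b =
  subst₂ _<_ (sym (toℕ-toFin inc a)) (sym (toℕ-toFin inc b)) (monotone inc a<b (toℕ<n b))

contains-by-indices : ∀ {m n p q r c} (A : Matrix m n) (B : Matrix p q) →
  (rows : Increasing p m r) (cols : Increasing q n c) →
  (∀ i j → B i j ≡ true → entry A (r (toℕ i)) (c (toℕ j)) ≡ true) → Contains A B
contains-by-indices A B rows cols hits =
  toFin rows , toFin cols , toFin-strictlyIncreasing rows , toFin-strictlyIncreasing cols ,
  λ i j Bij → trans (sym (entry-toℕ A (toFin rows i) (toFin cols j)))
                    (trans (cong₂ (entry A) (toℕ-toFin rows i) (toℕ-toFin cols j)) (hits i j Bij))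

X-true : ∀ k (i j : Fin k) → X k i j ≡ true → toℕ i ≡ toℕ j ⊎ toℕ i + toℕ j + 1 ≡ k
X-true k i j Xij with toℕ i ≟ toℕ j | toℕ i + toℕ j + 1 ≟ k
... | yes diagonal | _                 = inj₁ diagonal
... | no  _        | yes antidiagonal  = inj₂ antidiagonal
X-true k i j () | no _ | no _

fold-diagonal⇒contains-X : ∀ {h n e f} (A : Matrix (n + n) (n + n)) →
  Increasing h n e → Increasing h n f →
  (∀ {a} → a < h → fold n (entry A) (e a) (f a) ≡ true) → Contains A (X (h + h))
fold-diagonal⇒contains-X A rows cols folded =
  contains-by-indices A (X _) (Increasing-mirror rows) (Increasing-mirror cols)
    (λ i j Xij → mirror-hits-X (entry A) folded (toℕ<n i) (X-true _ i j Xij))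

zeros : ∀ {m n} → Matrix m n → ℕ
zeros A = countFin (λ i → countFin (λ j → bit (not (A i j))))

countFin-∑ : ∀ n (f : Fin n → ℕ) (g : ℕ → ℕ) → (∀ i → f i ≡ g (toℕ i)) → countFin f ≡ ∑ n g
countFin-∑ zero    f g f≗g = refl
countFin-∑ (suc n) f g f≗g = cong₂ _+_ (f≗g Fin.zero) (countFin-∑ n _ _ (f≗g ∘ Fin.suc))

countMatrix-∑ : ∀ {m n} (A : Matrix m n) (φ : Bool → ℕ) →
  countFin (λ i → countFin (λ j → φ (A i j))) ≡ ∑[ i < m ] ∑[ j < n ] φ (entry A i j)
countMatrix-∑ {m} {n} A φ = countFin-∑ m _ _ λ i →
  countFin-∑ n _ _ λ j → cong φ (sym (entry-toℕ A i j))

ones+zeros : ∀ {m n} (A : Matrix m n) → ones A + zeros A ≡ m * n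
ones+zeros {m} {n} A = begin
  ones A + zeros A
    ≡⟨ cong₂ _+_ (countMatrix-∑ A bit) (countMatrix-∑ A (bit ∘ not)) ⟩
  ∑[ i < m ] ∑[ j < n ] bit (entry A i j) + ∑[ i < m ] ∑[ j < n ] bit (not (entry A i j))
    ≡⟨ ∑-distrib-+ m _ _ ⟨
  ∑[ i < m ] (∑[ j < n ] bit (entry A i j) + ∑[ j < n ] bit (not (entry A i j)))
    ≡⟨ ∑-cong m (λ {i} _ → ∑-bits n (entry A i)) ⟩
  ∑[ _ < m ] n
    ≡⟨ ∑-const m n ⟩
  m * n
    ∎
  where open ≡-Reasoning

few-zeros⇒contains-X : ∀ z D → let k = (z + D) + (z + D) in
  (A : Matrix (k + k) (k + k)) → zeros A < suc D * suc z → Contains A (X k)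
few-zeros⇒contains-X z D A few =
  let d , d≤D , dense = sparse-diagonal (fold k M) fits fewInFold
      E , increasing , trues = enumerate-trues (z + h) (λ u → fold k M (u + d) u) dense
  in fold-diagonal⇒contains-X A
       (Increasing-weaken (≤-trans (+-monoʳ-≤ (z + h) d≤D) fits) (Increasing-+ d increasing))
       (Increasing-weaken (≤-trans (m≤m+n (z + h) D) fits) increasing)
       trues
  where
  h = z + D
  k = h + h
  M = entry A
  fits : z + h + D ≤ k
  fits = ≤-reflexive (halves z D)
    where
    halves : ∀ z D → z + (z + D) + D ≡ (z + D) + (z + D)
    halves = solve-∀
  fewInFold : cornerZeros k (fold k M) < suc D * suc z
  fewInFold = ≤-<-trans (cornerZeros-fold k M) (subst (_< suc D * suc z) (countMatrix-∑ A (bit ∘ not)) few)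

X-free⇒many-zeros : ∀ {k N} z D → k ≡ (z + D) + (z + D) → N ≡ k + k →
  (A : Matrix N N) → Avoids A (X k) → suc D * suc z ≤ zeros A
X-free⇒many-zeros z D refl refl A avoid = ≮⇒≥ (avoid ∘ few-zeros⇒contains-X z D A)

lemma5p3 : (t : ℕ) → let k = 6 * suc t in
    (A : Matrix (2 * k) (2 * k)) → Avoids A (X k) →
    18 * ones A + k * k < 18 * ((2 * k) * (2 * k))
lemma5p3 t A avoid = begin-strict
  18 * ones A + k * k             ≡⟨ square (ones A) m ⟩
  18 * (ones A + 2 * m * m)       <⟨ *-monoʳ-< 18 (+-monoʳ-< (ones A) (<-≤-trans 2m²<[2m+1][m+1] many)) ⟩
  18 * (ones A + zeros A)         ≡⟨ cong (18 *_) (ones+zeros A) ⟩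
  18 * ((2 * k) * (2 * k))        ∎
  where
  open ≤-Reasoning
  m = suc t
  k = 6 * m
  many : suc (2 * m) * suc m ≤ zeros A
  many = X-free⇒many-zeros m (2 * m) (six m) (double k) A avoid
    where
    six : ∀ m → 6 * m ≡ (m + 2 * m) + (m + 2 * m)
    six = solve-∀
    double : ∀ k → 2 * k ≡ k + k
    double = solve-∀
  2m²<[2m+1][m+1] : 2 * m * m < suc (2 * m) * suc m
  2m²<[2m+1][m+1] = subst (2 * m * m <_) (expand m) (s≤s (m≤m+n (2 * m * m) (3 * m)))
    where
    expand : ∀ m → 1 + (2 * m * m + 3 * m) ≡ (1 + 2 * m) * (1 + m)
    expand = solve-∀
  square : ∀ x m → 18 * x + 6 * m * (6 * m) ≡ 18 * (x + 2 * m * m)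
  square = solve-∀
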